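{- For every positive integer $k$, \[ B_{2k}=-\frac{k}{2^{2k-1}(2^{2k}-1)}\det\bigl(m_{i,j}\bigr)_{0\le i\le 2k-1,\ 1\le j\le 2k}, \] where the $2k\times 2k$ matrix has entries $m_{i,1}=1$; $m_{0,2}=2$ and $m_{i,2}=1$ for $i\ge1$; and for $3\le j\le 2k$, $m_{i,j}=2$ if $i=j-2$, $m_{i,j}=\binom{i}{j-2}$ if $i>j-2$, and $m_{i,j}=0$ if $i<j-2$.
   Context: The Bernoulli numbers $B_n$ are defined by $\frac{z}{e^z-1}=\sum_{n=0}^\infty B_n\frac{z^n}{n!}$ for $|z|<2\pi$. -}

module Defs where

open import Data.Nat as ℕ using (>-nonZero; ℕ; zero; suc; _∸_; _^_; _!; _≤_; _<_; s≤s; z≤n; NonZero)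
open import Data.Nat.Properties as ℕP using (m^n>0; _!≢0; m*n≢0; <-cmp; ≤-trans; *-monoʳ-≤; ∸-monoˡ-≤)
open import Relation.Binary.Definitions using (tri<; tri≈; tri>)
open import Data.Nat.Combinatorics using (_C_)
open import Data.Fin using (Fin; zero; suc; toℕ; punchIn; fromℕ)
open import Data.Vec using (Vec; []; _∷_; _∷ʳ_; lookup; tabulate; foldr)
open import Data.Integer using (+_)
open import Data.Rational using (ℚ; 0ℚ; 1ℚ; _+_; _*_; -_; _/_)

sumFin : (n : ℕ) → (Fin n → ℚ) → ℚ
sumFin zero    f = 0ℚ
sumFin (suc n) f = f zero + sumFin n (λ i → f (suc i))

sgn : ℕ → ℚ
sgn zero    = 1ℚ
sgn (suc m) = - sgn m

det : (n : ℕ) → (Fin n → Fin n → ℚ) → ℚ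
det zero    M = 1ℚ
det (suc n) M =
  sumFin (suc n) (λ j → sgn (toℕ j) * (M zero j * det n (λ r c → M (suc r) (punchIn j c))))

ℕ→ℚ : ℕ → ℚ
ℕ→ℚ n = + n / 1

invFact : ℕ → ℚ
invFact m = _/_ (+ 1) (m !) {{m !≢0}}

-- Bernoulli numbers via the generating function z/(e^z-1) = Σ B_n z^n/n!,
-- read as an identity of formal power series: writing c_n = B_n / n!,
-- (Σ c_n z^n) * ((e^z - 1)/z) = 1, where (e^z-1)/z = Σ z^n/(n+1)!.
-- Coefficientwise: c_0 = 1 and for n ≥ 1, Σ_{j=0}^{n} c_j /(n-j+1)! = 0,
-- i.e. c_n = - Σ_{j<n} c_j / (n-j+1)!.
-- bernCoeffs n = [c_0, …, c_n].
bernCoeffs : (n : ℕ) → Vec ℚ (suc n)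
bernCoeffs zero    = 1ℚ ∷ []
bernCoeffs (suc n) =
  bernCoeffs n ∷ʳ
    (- sumFin (suc n) (λ j → lookup (bernCoeffs n) j * invFact (suc (suc n ∸ toℕ j))))

bernoulli : ℕ → ℚ
bernoulli n = ℕ→ℚ (n !) * lookup (bernCoeffs n) (fromℕ n)

mEntry : ℕ → ℕ → ℚ
mEntry i zero = 0ℚ                       -- not used (columns start at 1)
mEntry i (suc zero) = 1ℚ
mEntry zero (suc (suc zero)) = ℕ→ℚ 2
mEntry (suc i) (suc (suc zero)) = 1ℚ
mEntry i (suc (suc (suc j'))) with <-cmp i (suc j')   -- here j - 2 = suc j'
... | tri< _ _ _ = 0ℚ
... | tri≈ _ _ _ = ℕ→ℚ 2
... | tri> _ _ _ = ℕ→ℚ (i C (suc j'))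

bernMatrix : (k : ℕ) → Fin (2 ℕ.* k) → Fin (2 ℕ.* k) → ℚ
bernMatrix k r c = mEntry (toℕ r) (suc (toℕ c))

denom : ℕ → ℕ
denom k = 2 ^ (2 ℕ.* k ∸ 1) ℕ.* (2 ^ (2 ℕ.* k) ∸ 1)

denom-nonZero : (k : ℕ) → 1 ≤ k → NonZero (denom k)
denom-nonZero (suc k) _ = m*n≢0 (2 ^ (2 ℕ.* suc k ∸ 1)) (2 ^ (2 ℕ.* suc k) ∸ 1)
  {{>-nonZero (m^n>0 2 (2 ℕ.* suc k ∸ 1))}} {{>-nonZero (lem (k ℕ.+ 1 ℕ.* suc k))}}
  where
  lem : ∀ m → 0 < 2 ^ suc m ∸ 1
  lem m = ∸-monoˡ-≤ 1 (*-monoʳ-≤ 2 (m^n>0 2 m))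

-- Write N = 2k and let L be Pascal's matrix plus the identity (entries C(r,t) below the diagonal,
-- 2 on it); the matrix of the theorem is [1 | L₀ … L_{N-2}], Lₜ the columns of L. If L y = 1, then
-- by multilinearity only the summand y_{N-1} L_{N-1} = 2 y_{N-1} e_{N-1} of the first column
-- survives, so the determinant is y_{N-1} · 2 · (-2)^{N-1}. The solution is y_t = V_{t+1}/(t+1)
-- with V_n = (2^n - 1) B_n + [n = 1]: multiplied by t + 1, the system L y = 1 becomes
-- ∑_j C(n,j) V_j + V_n = n, which follows from the Bernoulli recurrence ∑_j C(n,j) B_j = B_n + [n = 1]
-- and its dilated form ∑_j C(n,j) 2^j B_j = (2 - 2^n) B_n. Finally V_N = (2^N - 1) B_N for N ≥ 2.

module Submission where

open import Defs
open import Data.Nat using (ℕ; _≤_; _^_; _∸_)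
open import Data.Integer using (-_; +_)
open import Data.Rational using (ℚ; _*_; _/_)
open import Relation.Binary.PropositionalEquality using (_≡_)

open import Data.Nat as ℕ using (zero; suc; _<_; s≤s; z≤n; _!; NonZero)
import Data.Nat.Properties as ℕ
open import Data.Nat.Combinatorics
  using (_C_; nCk+nC[k+1]≡[n+1]C[k+1]; k>n⇒nCk≡0; nCn≡1; nC1≡n; nCk≡nC[n∸k]; nCk≡n!/k![n-k]!; k![n∸k]!∣n!)
open import Data.Nat.Coprimality as Coprime using (1-coprimeTo)
open import Data.Nat.DivMod using (m/n*n≡m)
open import Data.Nat.Induction using (<-rec)
import Data.Integer as ℤ
import Data.Integer.Properties as ℤ
open import Data.Rational as ℚ using (mkℚ; 0ℚ; 1ℚ; _+_; _-_; 1/_)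
open import Data.Rational.Properties
  using ( normalize-coprime; *-inverseʳ; *-assoc; *-comm; *-identityˡ; *-identityʳ; *-zeroˡ; *-zeroʳ
        ; *-distribˡ-+; *-distribʳ-+; +-comm; +-assoc; +-identityˡ; +-identityʳ; +-0-group; +-*-commutativeRing; _≟_)
open import Algebra.Properties.Group +-0-group using (identityˡ-unique)
open import Data.Fin using (Fin; zero; suc; toℕ; fromℕ; inject₁; punchIn)
open import Data.Fin.Properties using (toℕ-fromℕ; toℕ-inject₁)
open import Data.Vec using (Vec; []; _∷_; _∷ʳ_; lookup)
open import Data.Product using (∃-syntax; _,_)
open import Data.Sum using (_⊎_; inj₁; inj₂)
open import Data.Empty using (⊥-elim)
open import Function using (_∘_; _∘′_)
open import Induction.WellFounded using (WfRec)
open import Relation.Binary.Definitions using (tri<; tri≈; tri>)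
open import Relation.Binary.PropositionalEquality
  using (refl; sym; trans; cong; cong₂; subst; _≗_; module ≡-Reasoning)
open import Relation.Nullary.Decidable.Core using (dec⇒maybe)
open import Tactic.RingSolver using (solve-∀)
open import Tactic.RingSolver.Core.AlmostCommutativeRing using (AlmostCommutativeRing; fromCommutativeRing)

open ≡-Reasoning

ℚ-ring : AlmostCommutativeRing _ _
ℚ-ring = fromCommutativeRing +-*-commutativeRing (λ x → dec⇒maybe (0ℚ ≟ x))

ℕ→ℚ≡mkℚ : ∀ n → ℕ→ℚ n ≡ mkℚ (+ n) 0 (Coprime.sym (1-coprimeTo n))
ℕ→ℚ≡mkℚ n = normalize-coprime (Coprime.sym (1-coprimeTo n))

ℕ→ℚ-homo-+ : ∀ m n → ℕ→ℚ (m ℕ.+ n) ≡ ℕ→ℚ m + ℕ→ℚ n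
ℕ→ℚ-homo-+ m n = trans (cong (_/ 1) numerators) (cong₂ _+_ (sym (ℕ→ℚ≡mkℚ m)) (sym (ℕ→ℚ≡mkℚ n)))
  where
  numerators : + (m ℕ.+ n) ≡ + m ℤ.* + 1 ℤ.+ + n ℤ.* + 1
  numerators = sym (cong₂ ℤ._+_ (ℤ.*-identityʳ (+ m)) (ℤ.*-identityʳ (+ n)))

ℕ→ℚ-homo-* : ∀ m n → ℕ→ℚ (m ℕ.* n) ≡ ℕ→ℚ m * ℕ→ℚ n
ℕ→ℚ-homo-* m n = trans (cong (_/ 1) (ℤ.pos-* m n)) (cong₂ _*_ (sym (ℕ→ℚ≡mkℚ m)) (sym (ℕ→ℚ≡mkℚ n)))

ℕ→ℚ-homo-∸ : ∀ {m n} → n ≤ m → ℕ→ℚ (m ∸ n) ≡ ℕ→ℚ m - ℕ→ℚ n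
ℕ→ℚ-homo-∸ {m} {n} n≤m = begin
  ℕ→ℚ (m ∸ n)                       ≡⟨ add-sub (ℕ→ℚ (m ∸ n)) (ℕ→ℚ n) ⟩
  ℕ→ℚ (m ∸ n) + ℕ→ℚ n - ℕ→ℚ n       ≡⟨ cong (_- ℕ→ℚ n) (ℕ→ℚ-homo-+ (m ∸ n) n) ⟨
  ℕ→ℚ (m ∸ n ℕ.+ n) - ℕ→ℚ n         ≡⟨ cong (λ k → ℕ→ℚ k - ℕ→ℚ n) (ℕ.m∸n+n≡m n≤m) ⟩
  ℕ→ℚ m - ℕ→ℚ n                     ∎
  where
  add-sub : ∀ x z → x ≡ x + z - z
  add-sub = solve-∀ ℚ-ring

1/[1+_] : ℕ → ℚ
1/[1+ n ] = 1/ mkℚ (+ suc n) 0 (Coprime.sym (1-coprimeTo (suc n)))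

ℕ→ℚ-suc-inverseʳ : ∀ n → ℕ→ℚ (suc n) * 1/[1+ n ] ≡ 1ℚ
ℕ→ℚ-suc-inverseʳ n rewrite ℕ→ℚ≡mkℚ (suc n) = *-inverseʳ (mkℚ (+ suc n) 0 (Coprime.sym (1-coprimeTo (suc n))))

+a/[1+d]≡a*1/[1+d] : ∀ a d → + a / suc d ≡ ℕ→ℚ a * 1/[1+ d ]
+a/[1+d]≡a*1/[1+d] a d rewrite ℕ→ℚ≡mkℚ a =
  cong₂ (λ i m → i / suc m) (sym (ℤ.*-identityʳ (+ a))) (sym (ℕ.+-identityʳ d))

ℕ→ℚ-inverseʳ : ∀ d .{{_ : NonZero d}} → ℕ→ℚ d * (+ 1 / d) ≡ 1ℚ
ℕ→ℚ-inverseʳ (suc d) = begin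
  ℕ→ℚ (suc d) * (+ 1 / suc d)         ≡⟨ cong (ℕ→ℚ (suc d) *_) (+a/[1+d]≡a*1/[1+d] 1 d) ⟩
  ℕ→ℚ (suc d) * (1ℚ * 1/[1+ d ])      ≡⟨ cong (ℕ→ℚ (suc d) *_) (*-identityˡ 1/[1+ d ]) ⟩
  ℕ→ℚ (suc d) * 1/[1+ d ]             ≡⟨ ℕ→ℚ-suc-inverseʳ d ⟩
  1ℚ                                  ∎

ℕ→ℚ-suc-*-cancelˡ : ∀ n {x y} → ℕ→ℚ (suc n) * x ≡ ℕ→ℚ (suc n) * y → x ≡ y
ℕ→ℚ-suc-*-cancelˡ n {x} {y} eq = begin
  x                                   ≡⟨ unscale x ⟨
  1/[1+ n ] * (ℕ→ℚ (suc n) * x)       ≡⟨ cong (1/[1+ n ] *_) eq ⟩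
  1/[1+ n ] * (ℕ→ℚ (suc n) * y)       ≡⟨ unscale y ⟩
  y                                   ∎
  where
  unscale : ∀ z → 1/[1+ n ] * (ℕ→ℚ (suc n) * z) ≡ z
  unscale z = begin
    1/[1+ n ] * (ℕ→ℚ (suc n) * z)     ≡⟨ *-assoc 1/[1+ n ] (ℕ→ℚ (suc n)) z ⟨
    1/[1+ n ] * ℕ→ℚ (suc n) * z       ≡⟨ cong (_* z) (trans (*-comm 1/[1+ n ] (ℕ→ℚ (suc n))) (ℕ→ℚ-suc-inverseʳ n)) ⟩
    1ℚ * z                            ≡⟨ *-identityˡ z ⟩
    z                                 ∎

∑ : ℕ → (ℕ → ℚ) → ℚ
∑ zero    f = 0ℚ
∑ (suc n) f = ∑ n f + f n

infix 5 ∑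
syntax ∑ n (λ j → e) = ∑[ j < n ] e

∑-cong : ∀ n {f g : ℕ → ℚ} → (∀ {j} → j < n → f j ≡ g j) → ∑ n f ≡ ∑ n g
∑-cong zero    eq = refl
∑-cong (suc n) eq = cong₂ _+_ (∑-cong n (eq ∘ ℕ.m<n⇒m<1+n)) (eq ℕ.≤-refl)

∑-zero : ∀ n {f : ℕ → ℚ} → (∀ {j} → j < n → f j ≡ 0ℚ) → ∑ n f ≡ 0ℚ
∑-zero zero    eq = refl
∑-zero (suc n) eq = cong₂ _+_ (∑-zero n (eq ∘ ℕ.m<n⇒m<1+n)) (eq ℕ.≤-refl)

∑-trailing-zeros : ∀ m n {f : ℕ → ℚ} → (∀ {j} → n ≤ j → f j ≡ 0ℚ) → ∑ (m ℕ.+ n) f ≡ ∑ n f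
∑-trailing-zeros zero    n eq = refl
∑-trailing-zeros (suc m) n {f} eq = begin
  ∑ (m ℕ.+ n) f + f (m ℕ.+ n)   ≡⟨ cong₂ _+_ (∑-trailing-zeros m n eq) (eq (ℕ.m≤n+m n m)) ⟩
  ∑ n f + 0ℚ                    ≡⟨ +-identityʳ (∑ n f) ⟩
  ∑ n f                         ∎

∑-front : ∀ n (f : ℕ → ℚ) → ∑ (suc n) f ≡ f 0 + ∑ n (f ∘ suc)
∑-front zero    f = +-comm 0ℚ (f 0)
∑-front (suc n) f = trans (cong (_+ f (suc n)) (∑-front n f)) (+-assoc (f 0) (∑ n (f ∘ suc)) (f (suc n)))

∑-+ : ∀ n (f g : ℕ → ℚ) → ∑[ j < n ] (f j + g j) ≡ ∑ n f + ∑ n g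
∑-+ zero    f g = refl
∑-+ (suc n) f g = trans (cong (_+ (f n + g n)) (∑-+ n f g)) (interchange (∑ n f) (∑ n g) (f n) (g n))
  where
  interchange : ∀ a b c d → a + b + (c + d) ≡ a + c + (b + d)
  interchange = solve-∀ ℚ-ring

∑-distribˡ : ∀ n a (f : ℕ → ℚ) → ∑[ j < n ] (a * f j) ≡ a * ∑ n f
∑-distribˡ zero    a f = sym (*-zeroʳ a)
∑-distribˡ (suc n) a f = trans (cong (_+ a * f n) (∑-distribˡ n a f)) (sym (*-distribˡ-+ a (∑ n f) (f n)))

sumFin≡∑ : ∀ n (f : ℕ → ℚ) → sumFin n (f ∘ toℕ) ≡ ∑ n f
sumFin≡∑ zero    f = refl
sumFin≡∑ (suc n) f = trans (cong (λ s → f 0 + s) (sumFin≡∑ n (f ∘ suc))) (sym (∑-front n f))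

sumFin-cong : ∀ n {f g : Fin n → ℚ} → (∀ j → f j ≡ g j) → sumFin n f ≡ sumFin n g
sumFin-cong zero    eq = refl
sumFin-cong (suc n) eq = cong₂ _+_ (eq zero) (sumFin-cong n (eq ∘ suc))

binomial : (ℕ → ℚ) → ℕ → ℚ
binomial f n = ∑[ j < suc n ] (ℕ→ℚ (n C j) * f j)

binomial-cong : ∀ {f g} → f ≗ g → binomial f ≗ binomial g
binomial-cong eq n = ∑-cong (suc n) (λ {j} _ → cong (ℕ→ℚ (n C j) *_) (eq j))

binomial-+ : ∀ f g n → binomial (λ j → f j + g j) n ≡ binomial f n + binomial g n
binomial-+ f g n = trans (∑-cong (suc n) (λ {j} _ → *-distribˡ-+ (ℕ→ℚ (n C j)) (f j) (g j))) (∑-+ (suc n) _ _)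

binomial-* : ∀ a f n → binomial (λ j → a * f j) n ≡ a * binomial f n
binomial-* a f n = trans (∑-cong (suc n) (λ {j} _ → swap (ℕ→ℚ (n C j)) a (f j))) (∑-distribˡ (suc n) a _)
  where
  swap : ∀ c a x → c * (a * x) ≡ a * (c * x)
  swap = solve-∀ ℚ-ring

binomial-- : ∀ f g n → binomial (λ j → f j - g j) n ≡ binomial f n - binomial g n
binomial-- f g n = begin
  binomial (λ j → f j - g j) n              ≡⟨ binomial-cong (λ j → minus (f j) (g j)) n ⟩
  binomial (λ j → f j + ℚ.- 1ℚ * g j) n     ≡⟨ binomial-+ f (λ j → ℚ.- 1ℚ * g j) n ⟩
  binomial f n + binomial (λ j → ℚ.- 1ℚ * g j) n
                                            ≡⟨ cong (λ s → binomial f n + s) (binomial-* (ℚ.- 1ℚ) g n) ⟩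
  binomial f n + ℚ.- 1ℚ * binomial g n      ≡⟨ minus (binomial f n) (binomial g n) ⟨
  binomial f n - binomial g n               ∎
  where
  minus : ∀ x y → x - y ≡ x + ℚ.- 1ℚ * y
  minus = solve-∀ ℚ-ring

binomial≡∑<+last : ∀ f n → binomial f n ≡ (∑[ j < n ] (ℕ→ℚ (n C j) * f j)) + f n
binomial≡∑<+last f n rewrite nCn≡1 n = cong (λ x → (∑[ j < n ] (ℕ→ℚ (n C j) * f j)) + x) (*-identityˡ (f n))

binomial-suc : ∀ f n → binomial f (suc n) ≡ binomial f n + binomial (f ∘ suc) n
binomial-suc f n = begin
  binomial f (suc n)
    ≡⟨ ∑-front (suc n) _ ⟩
  1ℚ * f 0 + (∑[ j < suc n ] (ℕ→ℚ (suc n C suc j) * f (suc j)))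
    ≡⟨ cong (λ s → 1ℚ * f 0 + s) (trans (∑-cong (suc n) (λ {j} _ → pascal j)) (∑-+ (suc n) _ _)) ⟩
  1ℚ * f 0 + (binomial (f ∘ suc) n + tail (suc n))
    ≡⟨ regroup (1ℚ * f 0) (binomial (f ∘ suc) n) (tail (suc n)) ⟩
  1ℚ * f 0 + tail (suc n) + binomial (f ∘ suc) n
    ≡⟨ cong (λ t → 1ℚ * f 0 + t + binomial (f ∘ suc) n) (∑-trailing-zeros 1 n beyond) ⟩
  1ℚ * f 0 + tail n + binomial (f ∘ suc) n
    ≡⟨ cong (_+ binomial (f ∘ suc) n) (∑-front n _) ⟨
  binomial f n + binomial (f ∘ suc) n
    ∎
  where
  tail : ℕ → ℚ
  tail m = ∑[ j < m ] (ℕ→ℚ (n C suc j) * f (suc j))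
  pascal : ∀ j → ℕ→ℚ (suc n C suc j) * f (suc j)
               ≡ ℕ→ℚ (n C j) * f (suc j) + ℕ→ℚ (n C suc j) * f (suc j)
  pascal j = begin
    ℕ→ℚ (suc n C suc j) * f (suc j)
      ≡⟨ cong (λ c → ℕ→ℚ c * f (suc j)) (nCk+nC[k+1]≡[n+1]C[k+1] n j) ⟨
    ℕ→ℚ (n C j ℕ.+ n C suc j) * f (suc j)
      ≡⟨ cong (_* f (suc j)) (ℕ→ℚ-homo-+ (n C j) (n C suc j)) ⟩
    (ℕ→ℚ (n C j) + ℕ→ℚ (n C suc j)) * f (suc j)
      ≡⟨ *-distribʳ-+ (f (suc j)) (ℕ→ℚ (n C j)) (ℕ→ℚ (n C suc j)) ⟩
    ℕ→ℚ (n C j) * f (suc j) + ℕ→ℚ (n C suc j) * f (suc j)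
      ∎
  beyond : ∀ {j} → n ≤ j → ℕ→ℚ (n C suc j) * f (suc j) ≡ 0ℚ
  beyond {j} n≤j rewrite k>n⇒nCk≡0 (s≤s n≤j) = *-zeroˡ (f (suc j))
  regroup : ∀ a b c → a + (b + c) ≡ a + c + b
  regroup = solve-∀ ℚ-ring

binomial²-suc : ∀ g n → binomial (binomial g) (suc n)
                        ≡ ℕ→ℚ 2 * binomial (binomial g) n + binomial (binomial (g ∘ suc)) n
binomial²-suc g n = begin
  binomial (binomial g) (suc n)
    ≡⟨ binomial-suc (binomial g) n ⟩
  binomial (binomial g) n + binomial (binomial g ∘ suc) n
    ≡⟨ cong (λ s → binomial (binomial g) n + s) (binomial-cong (binomial-suc g) n) ⟩
  binomial (binomial g) n + binomial (λ j → binomial g j + binomial (g ∘ suc) j) n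
    ≡⟨ cong (λ s → binomial (binomial g) n + s) (binomial-+ (binomial g) (binomial (g ∘ suc)) n) ⟩
  binomial (binomial g) n + (binomial (binomial g) n + binomial (binomial (g ∘ suc)) n)
    ≡⟨ double (binomial (binomial g) n) _ ⟩
  ℕ→ℚ 2 * binomial (binomial g) n + binomial (binomial (g ∘ suc)) n
    ∎
  where
  double : ∀ a b → a + (a + b) ≡ ℕ→ℚ 2 * a + b
  double = solve-∀ ℚ-ring

dilate : (ℕ → ℚ) → ℕ → ℚ
dilate f j = ℕ→ℚ (2 ^ j) * f j

dilate-suc : ∀ f → dilate f ∘ suc ≗ λ j → ℕ→ℚ 2 * dilate (f ∘ suc) j
dilate-suc f j = trans (cong (_* f (suc j)) (ℕ→ℚ-homo-* 2 (2 ^ j))) (*-assoc (ℕ→ℚ 2) (ℕ→ℚ (2 ^ j)) (f (suc j)))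

binomial²-dilate : ∀ n f → binomial (binomial (dilate f)) n ≡ ℕ→ℚ (2 ^ n) * binomial f n
binomial²-dilate zero    f = ring (f 0)
  where
  ring : ∀ x → 0ℚ + 1ℚ * (0ℚ + 1ℚ * (1ℚ * x)) ≡ 1ℚ * (0ℚ + 1ℚ * x)
  ring = solve-∀ ℚ-ring
binomial²-dilate (suc n) f = begin
  binomial (binomial (dilate f)) (suc n)
    ≡⟨ binomial²-suc (dilate f) n ⟩
  ℕ→ℚ 2 * binomial (binomial (dilate f)) n + binomial (binomial (dilate f ∘ suc)) n
    ≡⟨ cong (λ s → ℕ→ℚ 2 * binomial (binomial (dilate f)) n + s) dilated-tail ⟩
  ℕ→ℚ 2 * binomial (binomial (dilate f)) n + ℕ→ℚ 2 * binomial (binomial (dilate (f ∘ suc))) n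
    ≡⟨ cong₂ (λ a b → ℕ→ℚ 2 * a + ℕ→ℚ 2 * b) (binomial²-dilate n f) (binomial²-dilate n (f ∘ suc)) ⟩
  ℕ→ℚ 2 * (ℕ→ℚ (2 ^ n) * binomial f n) + ℕ→ℚ 2 * (ℕ→ℚ (2 ^ n) * binomial (f ∘ suc) n)
    ≡⟨ factor (ℕ→ℚ 2) (ℕ→ℚ (2 ^ n)) _ _ ⟩
  ℕ→ℚ 2 * ℕ→ℚ (2 ^ n) * (binomial f n + binomial (f ∘ suc) n)
    ≡⟨ cong₂ _*_ (ℕ→ℚ-homo-* 2 (2 ^ n)) (binomial-suc f n) ⟨
  ℕ→ℚ (2 ^ suc n) * binomial f (suc n)
    ∎
  where
  dilated-tail : binomial (binomial (dilate f ∘ suc)) n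
                 ≡ ℕ→ℚ 2 * binomial (binomial (dilate (f ∘ suc))) n
  dilated-tail = begin
    binomial (binomial (dilate f ∘ suc)) n
      ≡⟨ binomial-cong (λ m → trans (binomial-cong (dilate-suc f) m) (binomial-* (ℕ→ℚ 2) (dilate (f ∘ suc)) m)) n ⟩
    binomial (λ m → ℕ→ℚ 2 * binomial (dilate (f ∘ suc)) m) n
      ≡⟨ binomial-* (ℕ→ℚ 2) _ n ⟩
    ℕ→ℚ 2 * binomial (binomial (dilate (f ∘ suc))) n
      ∎
  factor : ∀ t p a b → t * (p * a) + t * (p * b) ≡ t * p * (a + b)
  factor = solve-∀ ℚ-ring

[1+n]C[n]≡1+n : ∀ n → suc n C n ≡ suc n
[1+n]C[n]≡1+n n = begin
  suc n C n             ≡⟨ nCk≡nC[n∸k] (ℕ.n≤1+n n) ⟩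
  suc n C (suc n ∸ n)   ≡⟨ cong (suc n C_) (ℕ.m+n∸n≡m 1 n) ⟩
  suc n C 1             ≡⟨ nC1≡n (suc n) ⟩
  suc n                 ∎

-- The transform is unitriangular: at a fixed point ∑_{j ≤ n} C(n+1,j) D_j = 0, and by
-- strong induction only the top term (n+1) D_n survives.
binomial-fixedPoint≡0 : ∀ {D} → binomial D ≗ D → D ≗ λ _ → 0ℚ
binomial-fixedPoint≡0 {D} fixed = <-rec (λ n → D n ≡ 0ℚ) step
  where
  step : ∀ n → WfRec _<_ (λ m → D m ≡ 0ℚ) n → D n ≡ 0ℚ
  step n below = ℕ→ℚ-suc-*-cancelˡ n (begin
    ℕ→ℚ (suc n) * D n
      ≡⟨ cong (λ c → ℕ→ℚ c * D n) ([1+n]C[n]≡1+n n) ⟨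
    ℕ→ℚ (suc n C n) * D n
      ≡⟨ +-identityˡ _ ⟨
    0ℚ + ℕ→ℚ (suc n C n) * D n
      ≡⟨ cong (_+ ℕ→ℚ (suc n C n) * D n) lower-terms ⟨
    ∑[ j < suc n ] (ℕ→ℚ (suc n C j) * D j)
      ≡⟨ identityˡ-unique _ _ (trans (sym (binomial≡∑<+last D (suc n))) (fixed (suc n))) ⟩
    0ℚ
      ≡⟨ *-zeroʳ (ℕ→ℚ (suc n)) ⟨
    ℕ→ℚ (suc n) * 0ℚ
      ∎)
    where
    lower-terms : ∑[ j < n ] (ℕ→ℚ (suc n C j) * D j) ≡ 0ℚ
    lower-terms = ∑-zero n (λ {j} j<n → trans (cong (ℕ→ℚ (suc n C j) *_) (below j<n)) (*-zeroʳ (ℕ→ℚ (suc n C j))))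

δ₁ : ℕ → ℚ
δ₁ 1 = 1ℚ
δ₁ _ = 0ℚ

binomial-δ₁ : ∀ n → binomial δ₁ n ≡ ℕ→ℚ n
binomial-δ₁ zero    = refl
binomial-δ₁ (suc n) = begin
  binomial δ₁ (suc n)
    ≡⟨ trans (∑-front (suc n) _) (cong (λ s → ℕ→ℚ 1 * 0ℚ + s) (∑-front n _)) ⟩
  ℕ→ℚ 1 * 0ℚ + (ℕ→ℚ (suc n C 1) * 1ℚ + (∑[ j < n ] (ℕ→ℚ (suc n C suc (suc j)) * 0ℚ)))
    ≡⟨ cong₂ (λ c s → ℕ→ℚ 1 * 0ℚ + (ℕ→ℚ c * 1ℚ + s)) (nC1≡n (suc n)) (∑-zero n (λ {j} _ → *-zeroʳ (ℕ→ℚ (suc n C suc (suc j))))) ⟩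
  ℕ→ℚ 1 * 0ℚ + (ℕ→ℚ (suc n) * 1ℚ + 0ℚ)
    ≡⟨ ring (ℕ→ℚ (suc n)) ⟩
  ℕ→ℚ (suc n)
    ∎
  where
  ring : ∀ x → 1ℚ * 0ℚ + (x * 1ℚ + 0ℚ) ≡ x
  ring = solve-∀ ℚ-ring

fromℕ⊎inject₁ : ∀ {n} (i : Fin (suc n)) → i ≡ fromℕ n ⊎ ∃[ j ] i ≡ inject₁ j
fromℕ⊎inject₁ {zero}  zero    = inj₁ refl
fromℕ⊎inject₁ {suc n} zero    = inj₂ (zero , refl)
fromℕ⊎inject₁ {suc n} (suc i) with fromℕ⊎inject₁ i
... | inj₁ refl       = inj₁ refl
... | inj₂ (j , refl) = inj₂ (suc j , refl)

lookup-∷ʳ-fromℕ : ∀ {A : Set} {n} (xs : Vec A n) x → lookup (xs ∷ʳ x) (fromℕ n) ≡ x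
lookup-∷ʳ-fromℕ []       x = refl
lookup-∷ʳ-fromℕ (_ ∷ xs) x = lookup-∷ʳ-fromℕ xs x

lookup-∷ʳ-inject₁ : ∀ {A : Set} {n} (xs : Vec A n) x (i : Fin n) → lookup (xs ∷ʳ x) (inject₁ i) ≡ lookup xs i
lookup-∷ʳ-inject₁ (_ ∷ xs) x zero    = refl
lookup-∷ʳ-inject₁ (_ ∷ xs) x (suc i) = lookup-∷ʳ-inject₁ xs x i

bernCoeff : ℕ → ℚ
bernCoeff n = lookup (bernCoeffs n) (fromℕ n)

lookup-bernCoeffs : ∀ n (i : Fin (suc n)) → lookup (bernCoeffs n) i ≡ bernCoeff (toℕ i)
lookup-bernCoeffs zero    zero = refl
lookup-bernCoeffs (suc n) i with fromℕ⊎inject₁ i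
... | inj₁ refl       = cong bernCoeff (sym (toℕ-fromℕ (suc n)))
... | inj₂ (j , refl) = begin
  lookup (bernCoeffs n ∷ʳ _) (inject₁ j)   ≡⟨ lookup-∷ʳ-inject₁ (bernCoeffs n) _ j ⟩
  lookup (bernCoeffs n) j                  ≡⟨ lookup-bernCoeffs n j ⟩
  bernCoeff (toℕ j)                        ≡⟨ cong bernCoeff (toℕ-inject₁ j) ⟨
  bernCoeff (toℕ (inject₁ j))              ∎

bernCoeff-suc : ∀ n → bernCoeff (suc n) ≡ ℚ.- (∑[ j < suc n ] (bernCoeff j * invFact (suc (suc n ∸ j))))
bernCoeff-suc n = trans (lookup-∷ʳ-fromℕ (bernCoeffs n) _) (cong ℚ.-_ (begin
  sumFin (suc n) (λ j → lookup (bernCoeffs n) j * invFact (suc (suc n ∸ toℕ j)))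
    ≡⟨ sumFin-cong (suc n) (λ j → cong (_* invFact (suc (suc n ∸ toℕ j))) (lookup-bernCoeffs n j)) ⟩
  sumFin (suc n) (λ j → bernCoeff (toℕ j) * invFact (suc (suc n ∸ toℕ j)))
    ≡⟨ sumFin≡∑ (suc n) (λ j → bernCoeff j * invFact (suc (suc n ∸ j))) ⟩
  ∑[ j < suc n ] (bernCoeff j * invFact (suc (suc n ∸ j)))
    ∎))

nCk*[k!*[n∸k]!]≡n! : ∀ {n k} → k ≤ n → (n C k) ℕ.* (k ! ℕ.* (n ∸ k) !) ≡ n !
nCk*[k!*[n∸k]!]≡n! {n} {k} k≤n =
  trans (cong (ℕ._* (k ! ℕ.* (n ∸ k) !)) (nCk≡n!/k![n-k]! k≤n))
        (m/n*n≡m {{ℕ._!*_!≢0 k (n ∸ k)}} (k![n∸k]!∣n! k≤n))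

[1+n]C[1+k]*[1+k]≡[1+n]*nCk : ∀ n k → (suc n C suc k) ℕ.* suc k ≡ suc n ℕ.* (n C k)
[1+n]C[1+k]*[1+k]≡[1+n]*nCk n k with ℕ.≤-<-connex k n
... | inj₂ n<k rewrite k>n⇒nCk≡0 (s≤s n<k) | k>n⇒nCk≡0 n<k = sym (ℕ.*-zeroʳ (suc n))
... | inj₁ k≤n = ℕ.*-cancelʳ-≡ _ _ d {{ℕ._!*_!≢0 k (n ∸ k)}} (begin
  (suc n C suc k) ℕ.* suc k ℕ.* d       ≡⟨ ℕ.*-assoc (suc n C suc k) (suc k) d ⟩
  (suc n C suc k) ℕ.* (suc k ℕ.* d)     ≡⟨ cong ((suc n C suc k) ℕ.*_) (ℕ.*-assoc (suc k) (k !) ((n ∸ k) !)) ⟨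
  (suc n C suc k) ℕ.* (suc k ! ℕ.* (n ∸ k) !) ≡⟨ nCk*[k!*[n∸k]!]≡n! (s≤s k≤n) ⟩
  suc n ℕ.* n !                       ≡⟨ cong (suc n ℕ.*_) (nCk*[k!*[n∸k]!]≡n! k≤n) ⟨
  suc n ℕ.* ((n C k) ℕ.* d)             ≡⟨ ℕ.*-assoc (suc n) (n C k) d ⟨
  suc n ℕ.* (n C k) ℕ.* d             ∎)
  where
  d = k ! ℕ.* (n ∸ k) !

ℕ→ℚ-inverse-factorialʳ : ∀ m → ℕ→ℚ (m !) * invFact m ≡ 1ℚ
ℕ→ℚ-inverse-factorialʳ m = ℕ→ℚ-inverseʳ (m !) {{m ℕ.!≢0}}

C*factorial≡factorial*invFact : ∀ n j x → j ≤ n →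
  ℕ→ℚ (n C j) * (ℕ→ℚ (j !) * x) ≡ ℕ→ℚ (n !) * (x * invFact (n ∸ j))
C*factorial≡factorial*invFact n j x j≤n = begin
  c * (a * x)                  ≡⟨ *-identityʳ (c * (a * x)) ⟨
  c * (a * x) * 1ℚ             ≡⟨ cong (c * (a * x) *_) (ℕ→ℚ-inverse-factorialʳ (n ∸ j)) ⟨
  c * (a * x) * (d * i)        ≡⟨ regroup c a x d i ⟩
  c * (a * d) * (x * i)        ≡⟨ cong (_* (x * i)) factorials ⟩
  ℕ→ℚ (n !) * (x * i)          ∎
  where
  c = ℕ→ℚ (n C j)
  a = ℕ→ℚ (j !)
  d = ℕ→ℚ ((n ∸ j) !)
  i = invFact (n ∸ j)
  regroup : ∀ c a x d i → c * (a * x) * (d * i) ≡ c * (a * d) * (x * i)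
  regroup = solve-∀ ℚ-ring
  factorials : c * (a * d) ≡ ℕ→ℚ (n !)
  factorials = begin
    c * (a * d)                           ≡⟨ cong (c *_) (ℕ→ℚ-homo-* (j !) ((n ∸ j) !)) ⟨
    c * ℕ→ℚ (j ! ℕ.* (n ∸ j) !)           ≡⟨ ℕ→ℚ-homo-* (n C j) (j ! ℕ.* (n ∸ j) !) ⟨
    ℕ→ℚ ((n C j) ℕ.* (j ! ℕ.* (n ∸ j) !))   ≡⟨ cong ℕ→ℚ (nCk*[k!*[n∸k]!]≡n! j≤n) ⟩
    ℕ→ℚ (n !)                             ∎

bernoulli-∑< : ∀ n → ∑[ j < n ] (ℕ→ℚ (n C j) * bernoulli j) ≡ δ₁ n
bernoulli-∑< zero          = refl
bernoulli-∑< (suc zero)    = refl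
bernoulli-∑< (suc (suc m)) = begin
  ∑[ j < N ] (ℕ→ℚ (N C j) * bernoulli j)
    ≡⟨ ∑-cong N (λ {j} j<N → C*factorial≡factorial*invFact N j (bernCoeff j) (ℕ.<⇒≤ j<N)) ⟩
  ∑[ j < N ] (ℕ→ℚ (N !) * (bernCoeff j * invFact (N ∸ j)))
    ≡⟨ ∑-distribˡ N (ℕ→ℚ (N !)) (λ j → bernCoeff j * invFact (N ∸ j)) ⟩
  ℕ→ℚ (N !) * ((∑[ j < suc m ] (bernCoeff j * invFact (N ∸ j))) + bernCoeff (suc m) * invFact (N ∸ suc m))
    ≡⟨ cong₂ (λ s k → ℕ→ℚ (N !) * (s + bernCoeff (suc m) * invFact k))
             (∑-cong (suc m) (λ {j} j<1+m → cong (λ k → bernCoeff j * invFact k) (ℕ.+-∸-assoc 1 (ℕ.<⇒≤ j<1+m))))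
             (ℕ.m+n∸n≡m 1 (suc m)) ⟩
  ℕ→ℚ (N !) * (S + bernCoeff (suc m) * invFact 1)
    ≡⟨ cong (λ c → ℕ→ℚ (N !) * (S + c * invFact 1)) (bernCoeff-suc m) ⟩
  ℕ→ℚ (N !) * (S + ℚ.- S * invFact 1)
    ≡⟨ cancel (ℕ→ℚ (N !)) S ⟩
  0ℚ
    ∎
  where
  N = suc (suc m)
  S = ∑[ j < suc m ] (bernCoeff j * invFact (suc (suc m ∸ j)))
  cancel : ∀ a s → a * (s + ℚ.- s * 1ℚ) ≡ 0ℚ
  cancel = solve-∀ ℚ-ring

binomial-bernoulli : ∀ n → binomial bernoulli n ≡ bernoulli n + δ₁ n
binomial-bernoulli n = begin
  binomial bernoulli n                                         ≡⟨ binomial≡∑<+last bernoulli n ⟩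
  (∑[ j < n ] (ℕ→ℚ (n C j) * bernoulli j)) + bernoulli n       ≡⟨ cong (_+ bernoulli n) (bernoulli-∑< n) ⟩
  δ₁ n + bernoulli n                                           ≡⟨ +-comm (δ₁ n) (bernoulli n) ⟩
  bernoulli n + δ₁ n                                           ∎

2^n*δ₁≡2*δ₁ : ∀ n → ℕ→ℚ (2 ^ n) * δ₁ n ≡ ℕ→ℚ 2 * δ₁ n
2^n*δ₁≡2*δ₁ zero          = refl
2^n*δ₁≡2*δ₁ (suc zero)    = refl
2^n*δ₁≡2*δ₁ (suc (suc n)) = trans (*-zeroʳ (ℕ→ℚ (2 ^ suc (suc n)))) (sym (*-zeroʳ (ℕ→ℚ 2)))

-- D = dilate B + binomial (dilate B) - 2B is a fixed point of the binomial transform,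
-- by binomial²-dilate and binomial-bernoulli.
binomial-dilate-bernoulli : ∀ n → binomial (dilate bernoulli) n ≡ ℕ→ℚ 2 * bernoulli n - dilate bernoulli n
binomial-dilate-bernoulli n = begin
  t                        ≡⟨ isolate (dilate bernoulli n) t (bernoulli n) ⟩
  D n + (2b - P * b)       ≡⟨ cong (_+ (2b - P * b)) (binomial-fixedPoint≡0 fixed n) ⟩
  0ℚ + (2b - P * b)        ≡⟨ +-identityˡ (2b - P * b) ⟩
  2b - P * b               ∎
  where
  dB = dilate bernoulli
  t  = binomial dB n
  P  = ℕ→ℚ (2 ^ n)
  b  = bernoulli n
  2b = ℕ→ℚ 2 * b
  D : ℕ → ℚ
  D j = dB j + binomial dB j - ℕ→ℚ 2 * bernoulli j
  isolate : ∀ x t b → t ≡ x + t - ℕ→ℚ 2 * b + (ℕ→ℚ 2 * b - x)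
  isolate = solve-∀ ℚ-ring
  fixed : binomial D ≗ D
  fixed m = begin
    binomial D m
      ≡⟨ binomial-- (λ j → dB j + binomial dB j) (λ j → ℕ→ℚ 2 * bernoulli j) m ⟩
    binomial (λ j → dB j + binomial dB j) m - binomial (λ j → ℕ→ℚ 2 * bernoulli j) m
      ≡⟨ cong₂ _-_ (binomial-+ dB (binomial dB) m) (binomial-* (ℕ→ℚ 2) bernoulli m) ⟩
    binomial dB m + binomial (binomial dB) m - ℕ→ℚ 2 * binomial bernoulli m
      ≡⟨ cong (λ u → binomial dB m + u - ℕ→ℚ 2 * binomial bernoulli m) (binomial²-dilate m bernoulli) ⟩
    binomial dB m + Q * binomial bernoulli m - ℕ→ℚ 2 * binomial bernoulli m
      ≡⟨ cong (λ z → binomial dB m + Q * z - ℕ→ℚ 2 * z) (binomial-bernoulli m) ⟩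
    binomial dB m + Q * (c + d) - ℕ→ℚ 2 * (c + d)
      ≡⟨ cong (λ u → binomial dB m + u - ℕ→ℚ 2 * (c + d)) (*-distribˡ-+ Q c d) ⟩
    binomial dB m + (Q * c + Q * d) - ℕ→ℚ 2 * (c + d)
      ≡⟨ cong (λ u → binomial dB m + (Q * c + u) - ℕ→ℚ 2 * (c + d)) (2^n*δ₁≡2*δ₁ m) ⟩
    binomial dB m + (Q * c + ℕ→ℚ 2 * d) - ℕ→ℚ 2 * (c + d)
      ≡⟨ collect (binomial dB m) (Q * c) c d ⟩
    D m
      ∎
    where
    Q = ℕ→ℚ (2 ^ m)
    c = bernoulli m
    d = δ₁ m
    collect : ∀ t x c d → t + (x + ℕ→ℚ 2 * d) - ℕ→ℚ 2 * (c + d) ≡ x + t - ℕ→ℚ 2 * c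
    collect = solve-∀ ℚ-ring

V : ℕ → ℚ
V n = δ₁ n + dilate bernoulli n - bernoulli n

binomial-V : ∀ n → binomial V n + V n ≡ ℕ→ℚ n
binomial-V n = begin
  binomial V n + V n
    ≡⟨ cong (_+ V n) (binomial-- (λ j → δ₁ j + dilate bernoulli j) bernoulli n) ⟩
  binomial (λ j → δ₁ j + dilate bernoulli j) n - binomial bernoulli n + V n
    ≡⟨ cong (λ u → u - binomial bernoulli n + V n) (binomial-+ δ₁ (dilate bernoulli) n) ⟩
  binomial δ₁ n + binomial (dilate bernoulli) n - binomial bernoulli n + V n
    ≡⟨ cong (λ u → u + binomial (dilate bernoulli) n - binomial bernoulli n + V n) (binomial-δ₁ n) ⟩
  ℕ→ℚ n + binomial (dilate bernoulli) n - binomial bernoulli n + V n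
    ≡⟨ cong₂ (λ u v → ℕ→ℚ n + u - v + V n) (binomial-dilate-bernoulli n) (binomial-bernoulli n) ⟩
  ℕ→ℚ n + (ℕ→ℚ 2 * b - x) - (b + d) + (d + x - b)
    ≡⟨ cancel (ℕ→ℚ n) b x d ⟩
  ℕ→ℚ n
    ∎
  where
  b = bernoulli n
  x = dilate bernoulli n
  d = δ₁ n
  cancel : ∀ a b x d → a + (ℕ→ℚ 2 * b - x) - (b + d) + (d + x - b) ≡ a
  cancel = solve-∀ ℚ-ring

y : ℕ → ℚ
y t = V (suc t) * 1/[1+ t ]

[1+t]*y≡V : ∀ t → ℕ→ℚ (suc t) * y t ≡ V (suc t)
[1+t]*y≡V t = begin
  ℕ→ℚ (suc t) * (V (suc t) * 1/[1+ t ])   ≡⟨ swap (ℕ→ℚ (suc t)) (V (suc t)) 1/[1+ t ] ⟩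
  V (suc t) * (ℕ→ℚ (suc t) * 1/[1+ t ])   ≡⟨ cong (V (suc t) *_) (ℕ→ℚ-suc-inverseʳ t) ⟩
  V (suc t) * 1ℚ                          ≡⟨ *-identityʳ (V (suc t)) ⟩
  V (suc t)                               ∎
  where
  swap : ∀ a v r → a * (v * r) ≡ v * (a * r)
  swap = solve-∀ ℚ-ring

V-zero : V 0 ≡ 0ℚ
V-zero = refl

[1+r]*C*y≡C*V : ∀ r t → ℕ→ℚ (suc r) * (ℕ→ℚ (r C t) * y t) ≡ ℕ→ℚ (suc r C suc t) * V (suc t)
[1+r]*C*y≡C*V r t = begin
  ℕ→ℚ (suc r) * (ℕ→ℚ (r C t) * y t)                ≡⟨ *-assoc (ℕ→ℚ (suc r)) (ℕ→ℚ (r C t)) (y t) ⟨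
  ℕ→ℚ (suc r) * ℕ→ℚ (r C t) * y t                  ≡⟨ cong (_* y t) (ℕ→ℚ-homo-* (suc r) (r C t)) ⟨
  ℕ→ℚ (suc r ℕ.* (r C t)) * y t                    ≡⟨ cong (λ m → ℕ→ℚ m * y t) ([1+n]C[1+k]*[1+k]≡[1+n]*nCk r t) ⟨
  ℕ→ℚ ((suc r C suc t) ℕ.* suc t) * y t            ≡⟨ cong (_* y t) (ℕ→ℚ-homo-* (suc r C suc t) (suc t)) ⟩
  ℕ→ℚ (suc r C suc t) * ℕ→ℚ (suc t) * y t          ≡⟨ *-assoc (ℕ→ℚ (suc r C suc t)) (ℕ→ℚ (suc t)) (y t) ⟩
  ℕ→ℚ (suc r C suc t) * (ℕ→ℚ (suc t) * y t)        ≡⟨ cong (ℕ→ℚ (suc r C suc t) *_) ([1+t]*y≡V t) ⟩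
  ℕ→ℚ (suc r C suc t) * V (suc t)                  ∎

-- Multiplying the r-th equation by r + 1 turns it, via the absorption identity
-- (r+1) C(r,t) = (t+1) C(r+1,t+1), into the (r+1)-st instance of binomial-V.
y-solves : ∀ r → (∑[ t < r ] (ℕ→ℚ (r C t) * y t)) + ℕ→ℚ 2 * y r ≡ 1ℚ
y-solves r = ℕ→ℚ-suc-*-cancelˡ r (begin
  a * (S + ℕ→ℚ 2 * y r)                     ≡⟨ distrib a S (y r) ⟩
  a * S + ℕ→ℚ 2 * (a * y r)                 ≡⟨ cong₂ (λ u v → u + ℕ→ℚ 2 * v) absorbed ([1+t]*y≡V r) ⟩
  S′ + ℕ→ℚ 2 * v                            ≡⟨ split S′ v ⟩
  1ℚ * 0ℚ + S′ + v + v                      ≡⟨ cong (λ z → 1ℚ * z + S′ + v + v) V-zero ⟨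
  1ℚ * V 0 + S′ + v + v                     ≡⟨ cong (λ z → z + v + v) (∑-front r (λ j → ℕ→ℚ (suc r C j) * V j)) ⟨
  (∑[ j < suc r ] (ℕ→ℚ (suc r C j) * V j)) + v + v
                                            ≡⟨ cong (_+ v) (binomial≡∑<+last V (suc r)) ⟨
  binomial V (suc r) + v                    ≡⟨ binomial-V (suc r) ⟩
  a                                         ≡⟨ *-identityʳ a ⟨
  a * 1ℚ                                    ∎)
  where
  a = ℕ→ℚ (suc r)
  v = V (suc r)
  S = ∑[ t < r ] (ℕ→ℚ (r C t) * y t)
  S′ = ∑[ t < r ] (ℕ→ℚ (suc r C suc t) * V (suc t))
  absorbed : a * S ≡ S′
  absorbed = trans (sym (∑-distribˡ r a (λ t → ℕ→ℚ (r C t) * y t))) (∑-cong r (λ {t} _ → [1+r]*C*y≡C*V r t))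
  distrib : ∀ a s z → a * (s + ℕ→ℚ 2 * z) ≡ a * s + ℕ→ℚ 2 * (a * z)
  distrib = solve-∀ ℚ-ring
  split : ∀ s v → s + ℕ→ℚ 2 * v ≡ 1ℚ * 0ℚ + s + v + v
  split = solve-∀ ℚ-ring

L : ℕ → ℕ → ℚ
L r t = mEntry r (suc (suc t))

L-above : ∀ {r t} → r < t → L r t ≡ 0ℚ
L-above {zero}  {suc t} _   = refl
L-above {suc r} {suc t} r<t with ℕ.<-cmp (suc r) (suc t)
... | tri< _ _ _ = refl
... | tri≈ _ r≡t _ = ⊥-elim (ℕ.<-irrefl r≡t r<t)
... | tri> _ _ t<r = ⊥-elim (ℕ.<-asym r<t t<r)

L-diag : ∀ r → L r r ≡ ℕ→ℚ 2
L-diag zero    = refl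
L-diag (suc r) with ℕ.<-cmp (suc r) (suc r)
... | tri< r<r _ _ = ⊥-elim (ℕ.<-irrefl refl r<r)
... | tri≈ _ _ _   = refl
... | tri> _ _ r<r = ⊥-elim (ℕ.<-irrefl refl r<r)

L-below : ∀ {r t} → t < r → L r t ≡ ℕ→ℚ (r C t)
L-below {suc r} {zero}  _   = refl
L-below {suc r} {suc t} t<r with ℕ.<-cmp (suc r) (suc t)
... | tri< r<t _ _ = ⊥-elim (ℕ.<-asym r<t t<r)
... | tri≈ _ r≡t _ = ⊥-elim (ℕ.<-irrefl (sym r≡t) t<r)
... | tri> _ _ _   = refl

L-row : ∀ N (a : ℕ → ℚ) {r} → r < N →
  ∑[ t < N ] (a t * L r t) ≡ (∑[ t < r ] (ℕ→ℚ (r C t) * a t)) + ℕ→ℚ 2 * a r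
L-row N a {r} r<N = begin
  ∑ N f                     ≡⟨ cong (λ m → ∑ m f) (ℕ.m∸n+n≡m r<N) ⟨
  ∑ (N ∸ suc r ℕ.+ suc r) f ≡⟨ ∑-trailing-zeros (N ∸ suc r) (suc r) beyond ⟩
  ∑ r f + a r * L r r       ≡⟨ cong₂ _+_ (∑-cong r below) (trans (cong (a r *_) (L-diag r)) (*-comm (a r) (ℕ→ℚ 2))) ⟩
  (∑[ t < r ] (ℕ→ℚ (r C t) * a t)) + ℕ→ℚ 2 * a r ∎
  where
  f : ℕ → ℚ
  f t = a t * L r t
  beyond : ∀ {t} → suc r ≤ t → f t ≡ 0ℚ
  beyond {t} r<t = trans (cong (a t *_) (L-above r<t)) (*-zeroʳ (a t))
  below : ∀ {t} → t < r → f t ≡ ℕ→ℚ (r C t) * a t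
  below {t} t<r = trans (cong (a t *_) (L-below t<r)) (*-comm (a t) (ℕ→ℚ (r C t)))

Lcol : ℕ → ℕ → ℚ
Lcol t r = L r t

-- The window of L with rows i, i+1, … and columns i-1, i, …, whose first column is replaced by v.
bordered : ℕ → (ℕ → ℚ) → (n : ℕ) → Fin n → Fin n → ℚ
bordered i v n r zero    = v (i ℕ.+ toℕ r)
bordered i v n r (suc c) = L (i ℕ.+ toℕ r) (i ℕ.+ toℕ c)

-- borderDet i v n is the determinant of bordered i v (n + 1): the first row is (v i, 2, 0, …, 0),
-- so the Laplace expansion has only two terms.
borderDet : ℕ → (ℕ → ℚ) → ℕ → ℚ
borderDet i v zero    = v i
borderDet i v (suc n) = v i * borderDet (suc i) (Lcol i) n - ℕ→ℚ 2 * borderDet (suc i) v n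

det-cong : ∀ n {M N : Fin n → Fin n → ℚ} → (∀ r c → M r c ≡ N r c) → det n M ≡ det n N
det-cong zero    eq = refl
det-cong (suc n) eq = sumFin-cong (suc n) λ j →
  cong₂ (λ a b → sgn (toℕ j) * (a * b)) (eq zero j) (det-cong n (λ r c → eq (suc r) (punchIn j c)))

det-bordered : ∀ n i v → det (suc n) (bordered i v (suc n)) ≡ borderDet i v n
det-bordered zero    i v = trans (ring (v (i ℕ.+ 0))) (cong v (ℕ.+-identityʳ i))
  where
  ring : ∀ x → 1ℚ * (x * 1ℚ) + 0ℚ ≡ x
  ring = solve-∀ ℚ-ring
det-bordered (suc n) i v = begin
  1ℚ * (v (i ℕ.+ 0) * det (suc n) minor₀)
    + (ℚ.- 1ℚ * (L (i ℕ.+ 0) (i ℕ.+ 0) * det (suc n) minor₁) + sumFin n rest)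
    ≡⟨ cong₂ (λ a b → 1ℚ * (a * det (suc n) minor₀) + (ℚ.- 1ℚ * (b * det (suc n) minor₁) + sumFin n rest))
             (cong v (ℕ.+-identityʳ i)) (trans (cong₂ L (ℕ.+-identityʳ i) (ℕ.+-identityʳ i)) (L-diag i)) ⟩
  1ℚ * (v i * det (suc n) minor₀) + (ℚ.- 1ℚ * (ℕ→ℚ 2 * det (suc n) minor₁) + sumFin n rest)
    ≡⟨ cong₂ (λ a b → 1ℚ * (v i * a) + (ℚ.- 1ℚ * (ℕ→ℚ 2 * b) + sumFin n rest))
             (trans (det-cong (suc n) minor₀-shift) (det-bordered n (suc i) (Lcol i)))
             (trans (det-cong (suc n) minor₁-shift) (det-bordered n (suc i) v)) ⟩
  1ℚ * (v i * borderDet (suc i) (Lcol i) n) + (ℚ.- 1ℚ * (ℕ→ℚ 2 * borderDet (suc i) v n) + sumFin n rest)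
    ≡⟨ cong (λ s → 1ℚ * (v i * borderDet (suc i) (Lcol i) n) + (ℚ.- 1ℚ * (ℕ→ℚ 2 * borderDet (suc i) v n) + s))
            (trans (sumFin-cong n rest≡0) (sumFin-zero n)) ⟩
  1ℚ * (v i * borderDet (suc i) (Lcol i) n) + (ℚ.- 1ℚ * (ℕ→ℚ 2 * borderDet (suc i) v n) + 0ℚ)
    ≡⟨ expansion (v i) (borderDet (suc i) (Lcol i) n) (borderDet (suc i) v n) ⟩
  borderDet i v (suc n)
    ∎
  where
  M = bordered i v (suc (suc n))
  minor₀ minor₁ : Fin (suc n) → Fin (suc n) → ℚ
  minor₀ r c = M (suc r) (punchIn zero c)
  minor₁ r c = M (suc r) (punchIn (suc zero) c)
  rest : Fin n → ℚ
  rest j = sgn (suc (suc (toℕ j))) * (M zero (suc (suc j)) * det (suc n) (λ r c → M (suc r) (punchIn (suc (suc j)) c)))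
  rest≡0 : ∀ j → rest j ≡ 0ℚ
  rest≡0 j = begin
    s * (M zero (suc (suc j)) * d)    ≡⟨ cong (λ e → s * (e * d)) (L-above (ℕ.+-monoʳ-< i (s≤s z≤n))) ⟩
    s * (0ℚ * d)                      ≡⟨ annihilate s d ⟩
    0ℚ                                ∎
    where
    s = sgn (suc (suc (toℕ j)))
    d = det (suc n) (λ r c → M (suc r) (punchIn (suc (suc j)) c))
    annihilate : ∀ s d → s * (0ℚ * d) ≡ 0ℚ
    annihilate = solve-∀ ℚ-ring
  shift : ∀ m → i ℕ.+ suc m ≡ suc i ℕ.+ m
  shift m = ℕ.+-suc i m
  minor₀-shift : ∀ r c → minor₀ r c ≡ bordered (suc i) (Lcol i) (suc n) r c
  minor₀-shift r zero    = cong₂ L (shift (toℕ r)) (ℕ.+-identityʳ i)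
  minor₀-shift r (suc c) = cong₂ L (shift (toℕ r)) (shift (toℕ c))
  minor₁-shift : ∀ r c → minor₁ r c ≡ bordered (suc i) v (suc n) r c
  minor₁-shift r zero    = cong v (shift (toℕ r))
  minor₁-shift r (suc c) = cong₂ L (shift (toℕ r)) (shift (toℕ c))
  sumFin-zero : ∀ m → sumFin m (λ _ → 0ℚ) ≡ 0ℚ
  sumFin-zero zero    = refl
  sumFin-zero (suc m) = trans (+-identityˡ _) (sumFin-zero m)
  expansion : ∀ x a b → 1ℚ * (x * a) + (ℚ.- 1ℚ * (ℕ→ℚ 2 * b) + 0ℚ) ≡ x * a - ℕ→ℚ 2 * b
  expansion = solve-∀ ℚ-ring

borderDet-cong : ∀ n i {u w : ℕ → ℚ} → (∀ {d} → d ≤ n → u (i ℕ.+ d) ≡ w (i ℕ.+ d)) →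
  borderDet i u n ≡ borderDet i w n
borderDet-cong zero    i {u} {w} eq = trans (cong u (sym (ℕ.+-identityʳ i))) (trans (eq z≤n) (cong w (ℕ.+-identityʳ i)))
borderDet-cong (suc n) i {u} {w} eq = cong₂ (λ a b → a * borderDet (suc i) (Lcol i) n - ℕ→ℚ 2 * b)
  (borderDet-cong zero i {u} {w} (λ d≤0 → eq (ℕ.≤-trans d≤0 z≤n))) (borderDet-cong n (suc i) {u} {w} eq′)
  where
  eq′ : ∀ {d} → d ≤ n → u (suc i ℕ.+ d) ≡ w (suc i ℕ.+ d)
  eq′ {d} d≤n = subst (λ m → u m ≡ w m) (ℕ.+-suc i d) (eq (s≤s d≤n))

borderDet-+ : ∀ n i u w → borderDet i (λ r → u r + w r) n ≡ borderDet i u n + borderDet i w n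
borderDet-+ zero    i u w = refl
borderDet-+ (suc n) i u w = trans (cong (λ b → (u i + w i) * X - ℕ→ℚ 2 * b) (borderDet-+ n (suc i) u w))
                                  (ring (u i) (w i) X (borderDet (suc i) u n) (borderDet (suc i) w n))
  where
  X = borderDet (suc i) (Lcol i) n
  ring : ∀ a b x p q → (a + b) * x - ℕ→ℚ 2 * (p + q) ≡ a * x - ℕ→ℚ 2 * p + (b * x - ℕ→ℚ 2 * q)
  ring = solve-∀ ℚ-ring

borderDet-* : ∀ n i a u → borderDet i (λ r → a * u r) n ≡ a * borderDet i u n
borderDet-* zero    i a u = refl
borderDet-* (suc n) i a u = trans (cong (λ b → a * u i * X - ℕ→ℚ 2 * b) (borderDet-* n (suc i) a u))
                                  (ring a (u i) X (borderDet (suc i) u n))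
  where
  X = borderDet (suc i) (Lcol i) n
  ring : ∀ a b x p → a * b * x - ℕ→ℚ 2 * (a * p) ≡ a * (b * x - ℕ→ℚ 2 * p)
  ring = solve-∀ ℚ-ring

borderDet-0 : ∀ n i → borderDet i (λ _ → 0ℚ) n ≡ 0ℚ
borderDet-0 zero    i = refl
borderDet-0 (suc n) i = trans (cong (λ b → 0ℚ * X - ℕ→ℚ 2 * b) (borderDet-0 n (suc i))) (ring X)
  where
  X = borderDet (suc i) (Lcol i) n
  ring : ∀ x → 0ℚ * x - ℕ→ℚ 2 * 0ℚ ≡ 0ℚ
  ring = solve-∀ ℚ-ring

borderDet-∑ : ∀ m n i (a : ℕ → ℚ) (f : ℕ → ℕ → ℚ) →
  borderDet i (λ r → ∑[ t < m ] (a t * f t r)) n ≡ ∑[ t < m ] (a t * borderDet i (f t) n)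
borderDet-∑ zero    n i a f = borderDet-0 n i
borderDet-∑ (suc m) n i a f = begin
  borderDet i (λ r → (∑[ t < m ] (a t * f t r)) + a m * f m r) n
    ≡⟨ borderDet-+ n i (λ r → ∑[ t < m ] (a t * f t r)) (λ r → a m * f m r) ⟩
  borderDet i (λ r → ∑[ t < m ] (a t * f t r)) n + borderDet i (λ r → a m * f m r) n
    ≡⟨ cong₂ _+_ (borderDet-∑ m n i a f) (borderDet-* n i (a m) (f m)) ⟩
  (∑[ t < m ] (a t * borderDet i (f t) n)) + a m * borderDet i (f m) n
    ∎

-- A repeated column: Lcol (i + d) is the (d+1)-st column of the window.
borderDet-Lcol : ∀ n i {d} → d < n → borderDet i (Lcol (i ℕ.+ d)) n ≡ 0ℚ
borderDet-Lcol (suc n) i {zero} _ = begin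
  Lcol (i ℕ.+ 0) i * X - ℕ→ℚ 2 * borderDet (suc i) (Lcol (i ℕ.+ 0)) n
    ≡⟨ cong (λ c → Lcol c i * X - ℕ→ℚ 2 * borderDet (suc i) (Lcol c) n) (ℕ.+-identityʳ i) ⟩
  L i i * X - ℕ→ℚ 2 * X
    ≡⟨ cong (λ e → e * X - ℕ→ℚ 2 * X) (L-diag i) ⟩
  ℕ→ℚ 2 * X - ℕ→ℚ 2 * X
    ≡⟨ ring X ⟩
  0ℚ
    ∎
  where
  X = borderDet (suc i) (Lcol i) n
  ring : ∀ x → ℕ→ℚ 2 * x - ℕ→ℚ 2 * x ≡ 0ℚ
  ring = solve-∀ ℚ-ring
borderDet-Lcol (suc n) i {suc d} (s≤s d<n) = begin
  L i (i ℕ.+ suc d) * X - ℕ→ℚ 2 * borderDet (suc i) (Lcol (i ℕ.+ suc d)) n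
    ≡⟨ cong₂ (λ e c → e * X - ℕ→ℚ 2 * borderDet (suc i) (Lcol c) n) (L-above (ℕ.m<m+n i (s≤s z≤n))) (ℕ.+-suc i d) ⟩
  0ℚ * X - ℕ→ℚ 2 * borderDet (suc i) (Lcol (suc i ℕ.+ d)) n
    ≡⟨ cong (λ b → 0ℚ * X - ℕ→ℚ 2 * b) (borderDet-Lcol n (suc i) d<n) ⟩
  0ℚ * X - ℕ→ℚ 2 * 0ℚ
    ≡⟨ ring X ⟩
  0ℚ
    ∎
  where
  X = borderDet (suc i) (Lcol i) n
  ring : ∀ x → 0ℚ * x - ℕ→ℚ 2 * 0ℚ ≡ 0ℚ
  ring = solve-∀ ℚ-ring

borderDet-unit : ∀ n i {v : ℕ → ℚ} → (∀ {d} → d < n → v (i ℕ.+ d) ≡ 0ℚ) → v (i ℕ.+ n) ≡ ℕ→ℚ 2 →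
  borderDet i v n ≡ sgn n * ℕ→ℚ (2 ^ suc n)
borderDet-unit zero    i {v} _    top = trans (cong v (sym (ℕ.+-identityʳ i))) (trans top (sym (*-identityˡ (ℕ→ℚ 2))))
borderDet-unit (suc n) i {v} vanish top = begin
  v i * X - ℕ→ℚ 2 * borderDet (suc i) v n
    ≡⟨ cong₂ (λ a b → a * X - ℕ→ℚ 2 * b) (trans (cong v (sym (ℕ.+-identityʳ i))) (vanish (s≤s z≤n)))
             (borderDet-unit n (suc i) vanish′ top′) ⟩
  0ℚ * X - ℕ→ℚ 2 * (sgn n * ℕ→ℚ (2 ^ suc n))
    ≡⟨ ring X (sgn n) (ℕ→ℚ (2 ^ suc n)) ⟩
  ℚ.- sgn n * (ℕ→ℚ 2 * ℕ→ℚ (2 ^ suc n))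
    ≡⟨ cong (ℚ.- sgn n *_) (ℕ→ℚ-homo-* 2 (2 ^ suc n)) ⟨
  sgn (suc n) * ℕ→ℚ (2 ^ suc (suc n))
    ∎
  where
  X = borderDet (suc i) (Lcol i) n
  vanish′ : ∀ {d} → d < n → v (suc i ℕ.+ d) ≡ 0ℚ
  vanish′ {d} d<n = subst (λ m → v m ≡ 0ℚ) (ℕ.+-suc i d) (vanish (s≤s d<n))
  top′ : v (suc i ℕ.+ n) ≡ ℕ→ℚ 2
  top′ = subst (λ m → v m ≡ ℕ→ℚ 2) (ℕ.+-suc i n) top
  ring : ∀ x s p → 0ℚ * x - ℕ→ℚ 2 * (s * p) ≡ ℚ.- s * (ℕ→ℚ 2 * p)
  ring = solve-∀ ℚ-ring

-- If L a = 1 on the rows 0 … n, the all-ones first column is ∑ a_t (column t of L); all but the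
-- last of these columns already occur in the matrix.
det-bordered-ones : ∀ n (a : ℕ → ℚ) →
  (∀ {r} → r ≤ n → (∑[ t < r ] (ℕ→ℚ (r C t) * a t)) + ℕ→ℚ 2 * a r ≡ 1ℚ) →
  det (suc n) (bordered 0 (λ _ → 1ℚ) (suc n)) ≡ a n * (sgn n * ℕ→ℚ (2 ^ suc n))
det-bordered-ones n a solves = begin
  det (suc n) (bordered 0 (λ _ → 1ℚ) (suc n))
    ≡⟨ det-bordered n 0 (λ _ → 1ℚ) ⟩
  borderDet 0 (λ _ → 1ℚ) n
    ≡⟨ borderDet-cong n 0 (λ d≤n → sym (trans (L-row (suc n) a (s≤s d≤n)) (solves d≤n))) ⟩
  borderDet 0 (λ r → ∑[ t < suc n ] (a t * Lcol t r)) n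
    ≡⟨ borderDet-∑ (suc n) n 0 a Lcol ⟩
  (∑[ t < n ] (a t * borderDet 0 (Lcol t) n)) + a n * borderDet 0 (Lcol n) n
    ≡⟨ cong (_+ a n * borderDet 0 (Lcol n) n) (∑-zero n (λ {t} t<n → trans (cong (a t *_) (borderDet-Lcol n 0 t<n)) (*-zeroʳ (a t)))) ⟩
  0ℚ + a n * borderDet 0 (Lcol n) n
    ≡⟨ +-identityˡ (a n * borderDet 0 (Lcol n) n) ⟩
  a n * borderDet 0 (Lcol n) n
    ≡⟨ cong (a n *_) (borderDet-unit n 0 L-above (L-diag n)) ⟩
  a n * (sgn n * ℕ→ℚ (2 ^ suc n))
    ∎

sgn-double : ∀ m → sgn (m ℕ.+ m) ≡ 1ℚ
sgn-double zero    = refl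
sgn-double (suc m) = begin
  sgn (suc (m ℕ.+ suc m))     ≡⟨ cong (sgn ∘′ suc) (ℕ.+-suc m m) ⟩
  ℚ.- (ℚ.- sgn (m ℕ.+ m))     ≡⟨ cong (λ s → ℚ.- (ℚ.- s)) (sgn-double m) ⟩
  ℚ.- (ℚ.- 1ℚ)                ≡⟨⟩
  1ℚ                          ∎

V-≥2 : ∀ {m} → 2 ≤ m → V m ≡ (ℕ→ℚ (2 ^ m) - 1ℚ) * bernoulli m
V-≥2 {m} (s≤s (s≤s _)) = ring (ℕ→ℚ (2 ^ m)) (bernoulli m)
  where
  ring : ∀ p b → 0ℚ + p * b - b ≡ (p - 1ℚ) * b
  ring = solve-∀ ℚ-ring

bernMatrix≡bordered : ∀ k r c → bernMatrix (suc k) r c ≡ bordered 0 (λ _ → 1ℚ) (2 ℕ.* suc k) r c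
bernMatrix≡bordered k r zero    = refl
bernMatrix≡bordered k r (suc c) = refl

[1+k]*det≡-denom*bernoulli : ∀ k →
  ℕ→ℚ (suc k) * det (2 ℕ.* suc k) (bernMatrix (suc k)) ≡ ℚ.- (ℕ→ℚ (denom (suc k)) * bernoulli (2 ℕ.* suc k))
[1+k]*det≡-denom*bernoulli k = begin
  K * det N (bernMatrix (suc k))
    ≡⟨ cong (K *_) (trans (det-cong N (bernMatrix≡bordered k)) (det-bordered-ones n y (λ {r} _ → y-solves r))) ⟩
  K * (y n * (sgn n * ℕ→ℚ (2 ^ N)))
    ≡⟨ cong₂ (λ s p → K * (y n * (s * p))) sgn-odd (ℕ→ℚ-homo-* 2 (2 ^ n)) ⟩
  K * (y n * (ℚ.- 1ℚ * (ℕ→ℚ 2 * Q)))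
    ≡⟨ regroup K (y n) Q ⟩
  ℚ.- (ℕ→ℚ 2 * K * y n * Q)
    ≡⟨ cong (λ a → ℚ.- (a * y n * Q)) (ℕ→ℚ-homo-* 2 (suc k)) ⟨
  ℚ.- (ℕ→ℚ N * y n * Q)
    ≡⟨ cong (λ v → ℚ.- (v * Q)) ([1+t]*y≡V n) ⟩
  ℚ.- (V N * Q)
    ≡⟨ cong (λ v → ℚ.- (v * Q)) (V-≥2 {N} (ℕ.*-monoʳ-≤ 2 (s≤s (z≤n {k})))) ⟩
  ℚ.- ((ℕ→ℚ (2 ^ N) - 1ℚ) * B * Q)
    ≡⟨ cong (λ d → ℚ.- (d * B * Q)) (ℕ→ℚ-homo-∸ (ℕ.m^n>0 2 N)) ⟨
  ℚ.- (ℕ→ℚ (2 ^ N ∸ 1) * B * Q)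
    ≡⟨ cong ℚ.-_ (commute (ℕ→ℚ (2 ^ N ∸ 1)) B Q) ⟩
  ℚ.- (Q * ℕ→ℚ (2 ^ N ∸ 1) * B)
    ≡⟨ cong (λ d → ℚ.- (d * B)) (ℕ→ℚ-homo-* (2 ^ n) (2 ^ N ∸ 1)) ⟨
  ℚ.- (ℕ→ℚ (denom (suc k)) * B)
    ∎
  where
  N = 2 ℕ.* suc k
  n = N ∸ 1
  K = ℕ→ℚ (suc k)
  Q = ℕ→ℚ (2 ^ n)
  B = bernoulli N
  sgn-odd : sgn n ≡ ℚ.- 1ℚ
  sgn-odd = begin
    sgn n                         ≡⟨ cong (λ m → sgn (k ℕ.+ suc m)) (ℕ.+-identityʳ k) ⟩
    sgn (k ℕ.+ suc k)             ≡⟨ cong sgn (ℕ.+-suc k k) ⟩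
    ℚ.- sgn (k ℕ.+ k)             ≡⟨ cong ℚ.-_ (sgn-double k) ⟩
    ℚ.- 1ℚ                        ∎
  regroup : ∀ a z q → a * (z * (ℚ.- 1ℚ * (ℕ→ℚ 2 * q))) ≡ ℚ.- (ℕ→ℚ 2 * a * z * q)
  regroup = solve-∀ ℚ-ring
  commute : ∀ d b q → d * b * q ≡ q * d * b
  commute = solve-∀ ℚ-ring

[1+k]*x≡-d*b⇒b≡-[1+k]/d*x : ∀ k d .{{_ : NonZero d}} {x b} →
  ℕ→ℚ (suc k) * x ≡ ℚ.- (ℕ→ℚ d * b) → b ≡ (- (+ suc k) / d) * x
[1+k]*x≡-d*b⇒b≡-[1+k]/d*x k (suc d) {x} {b} eq = ℕ→ℚ-suc-*-cancelˡ d (sym (begin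
  D * ((- (+ suc k) / suc d) * x)             ≡⟨ cong (λ q → D * (ℚ.- q * x)) (+a/[1+d]≡a*1/[1+d] (suc k) d) ⟩
  D * (ℚ.- (K * 1/[1+ d ]) * x)               ≡⟨ regroup D K 1/[1+ d ] x ⟩
  ℚ.- (D * 1/[1+ d ] * (K * x))               ≡⟨ cong₂ (λ u v → ℚ.- (u * v)) (ℕ→ℚ-suc-inverseʳ d) eq ⟩
  ℚ.- (1ℚ * ℚ.- (D * b))                      ≡⟨ unneg (D * b) ⟩
  D * b                                       ∎))
  where
  D = ℕ→ℚ (suc d)
  K = ℕ→ℚ (suc k)
  regroup : ∀ d k r x → d * (ℚ.- (k * r) * x) ≡ ℚ.- (d * r * (k * x))
  regroup = solve-∀ ℚ-ring
  unneg : ∀ z → ℚ.- (1ℚ * ℚ.- z) ≡ z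
  unneg = solve-∀ ℚ-ring

mainTheorem9 : (k : ℕ) → (hk : 1 ≤ k) →
    bernoulli (2 Data.Nat.* k)
      ≡ _/_ (- (+ k)) (denom k) {{denom-nonZero k hk}} * det (2 Data.Nat.* k) (bernMatrix k)
mainTheorem9 (suc k) hk =
  [1+k]*x≡-d*b⇒b≡-[1+k]/d*x k (denom (suc k)) {{denom-nonZero (suc k) hk}} ([1+k]*det≡-denom*bernoulli k)
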